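{- Let $m,t\ge 0$ be integers with $t\le M:=\binom{m+1}{2}$. Let $T$ be a SYT of shifted staircase shape $[m]$. Let $T_1$ be the set of cells of $T$ (with their entries) whose entries are at most $t$, and let $T_2$ be obtained from $T\setminus T_1$ by moving each cell $(i,j)$ to position $(m+1-j,\,m+1-i)$ (reflection of the shape) and replacing its entry $x$ by $M-x+1$. Then: (i) $T_1$ and $T_2$ are SYT of shifted shapes; (ii) denoting their shifted shapes (strict partitions) by $\lambda^1$ and $\lambda^2$, the set $\{1,\ldots,m\}$ of parts of $[m]$ is the disjoint union of the set of parts of $\lambda^1$ and the set of parts of $\lambda^2$.
   Context: For a strict partition $\lambda=(\lambda_1>\cdots>\lambda_\ell>0)$, the shifted diagram consists of cells $(i,j)$ with $1\le i\le\ell$, $i\le j\le\lambda_i+i-1$. A SYT of shifted shape $\lambda$ is a filling of these cells by $1,\ldots,|\lambda|$, each once, increasing along rows and down columns. $[m]=(m,m-1,\ldots,1)$ is the shifted staircase, with cells $(i,j)$, $1\le i\le j\le m$. -}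

module Defs where

open import Data.Nat using (ℕ; zero; suc; _+_; _∸_; _≤_; _<_)
open import Data.Nat.Combinatorics using (_C_)
open import Data.List using (List; []; _∷_; length)
open import Data.Nat.ListAction using (sum)
open import Data.List.Relation.Unary.All using (All)
open import Data.List.Relation.Unary.Linked using (Linked)
open import Data.List.Membership.Propositional using (_∈_)
open import Data.Product using (_×_; Σ; ∃; ∃-syntax)
open import Data.Sum using (_⊎_)
open import Data.Empty using (⊥)
open import Relation.Binary.PropositionalEquality using (_≡_)

_↔_ : Set → Set → Set
A ↔ B = (A → B) × (B → A)

StrictPartition : List ℕ → Set
StrictPartition λ' = All (0 <_) λ' × Linked (λ a b → b < a) λ'

-- part λ i = λ_i (1-indexed); 0 if i = 0 or i > ℓ.
part : List ℕ → ℕ → ℕ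
part []       _             = 0
part (x ∷ xs) zero          = 0
part (x ∷ xs) (suc zero)    = x
part (x ∷ xs) (suc (suc k)) = part xs (suc k)

size : List ℕ → ℕ
size = sum

InShifted : List ℕ → ℕ → ℕ → Set
InShifted λ' i j = (1 ≤ i) × (i ≤ length λ') × (i ≤ j) × (j < part λ' i + i)

-- A filling F (values outside the diagram are irrelevant) is a SYT of
-- shifted shape λ: entries 1..|λ| each exactly once, increasing along
-- rows and down columns.
IsShiftedSYT : List ℕ → (ℕ → ℕ → ℕ) → Set
IsShiftedSYT λ' F =
    (∀ i j → InShifted λ' i j → (1 ≤ F i j) × (F i j ≤ size λ'))
  × (∀ i j i' j' → InShifted λ' i j → InShifted λ' i' j' →
       F i j ≡ F i' j' → (i ≡ i') × (j ≡ j'))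
  × (∀ k → 1 ≤ k → k ≤ size λ' → ∃[ i ] ∃[ j ] (InShifted λ' i j × F i j ≡ k))
  × (∀ i j j' → InShifted λ' i j → InShifted λ' i j' → j < j' → F i j < F i j')
  × (∀ i i' j → InShifted λ' i j → InShifted λ' i' j → i < i' → F i j < F i' j)

staircase : ℕ → List ℕ
staircase zero    = []
staircase (suc m) = suc m ∷ staircase m

bigM : ℕ → ℕ
bigM m = suc m C 2

T₂fill : ℕ → (ℕ → ℕ → ℕ) → ℕ → ℕ → ℕ
T₂fill m T i' j' = bigM m + 1 ∸ T (suc m ∸ j') (suc m ∸ i')

-- Since T increases along rows and columns, its cells with entries at most t form a down-set of
-- the staircase [m]; row by row, a down-set of [m] is the shifted diagram of a strict partition λ¹
-- with parts at most m, and |λ¹| = t because T takes each of the values 1, …, t exactly once.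
-- The reflection (i, j) ↦ (m+1−j, m+1−i) maps [m] onto itself, and the reflected complement of the
-- diagram of λ¹ is the diagram of the strict partition λ² formed by the numbers in {1, …, m} that
-- are not parts of λ¹: removing the first row and column of [m] reduces this to [m−1], with λ¹
-- losing its first part if it equals m and unchanged otherwise. Reflecting reverses both orders,
-- so x ↦ M+1−x turns the entries of T on these cells into a standard filling of λ².
module Submission where

open import Defs
open import Data.Nat using (ℕ; zero; suc; _+_; _∸_; _≤_; _<_; _>_; z≤n; s≤s; _≟_; _≤?_; pred)
open import Data.Nat.Properties
open import Data.Nat.Combinatorics using (nCk+nC[k+1]≡[n+1]C[k+1]; nC1≡n)
open import Data.List using (List; []; _∷_; filter)
open import Data.List.Properties using (filter-accept; filter-reject)
open import Data.List.Membership.Propositional using (_∈_; _∉_)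
open import Data.List.Membership.Propositional.Properties using (∈-filter⁺; ∈-filter⁻)
open import Data.List.Membership.DecPropositional _≟_ using (_∈?_; _∉?_)
open import Data.List.Relation.Unary.Any using (here; there)
open import Data.List.Relation.Unary.All as All using (All; []; _∷_)
open import Data.List.Relation.Unary.Linked as Linked using (Linked; []; [-]; _∷_)
import Data.List.Relation.Unary.All.Properties as Allₚ
import Data.List.Relation.Unary.Linked.Properties as Linkedₚ
open import Data.Product using (_×_; _,_; proj₁; proj₂; ∃; ∃-syntax)
open import Data.Sum using (_⊎_; inj₁; inj₂; map₁)
open import Data.Empty using (⊥; ⊥-elim)
open import Function using (id; _∘_)
open import Relation.Unary using (Decidable)
open import Relation.Nullary using (¬_; Dec; yes; no)
open import Relation.Binary.PropositionalEquality
open import Algebra.Properties.CommutativeSemigroup +-commutativeSemigroup using (interchange; x∙yz≈y∙xz)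

-- Cells of shifted diagrams

-- Row i + 1 of the shifted diagram of x ∷ μ is row i of that of μ, moved one column to the right.
Cell : List ℕ → ℕ → ℕ → Set
Cell []      _             _       = ⊥
Cell (x ∷ μ) zero          _       = ⊥
Cell (x ∷ μ) (suc zero)    j       = 1 ≤ j × j ≤ x
Cell (x ∷ μ) (suc (suc i)) zero    = ⊥
Cell (x ∷ μ) (suc (suc i)) (suc j) = Cell μ (suc i) j

InShifted⇔Cell : ∀ λ' i j → InShifted λ' i j ↔ Cell λ' i j
InShifted⇔Cell [] i j = (λ (1≤i , i≤0 , _) → 1+n≰n (≤-trans 1≤i i≤0)) , λ ()
InShifted⇔Cell (x ∷ μ) zero j = (λ ()) , λ ()
InShifted⇔Cell (x ∷ μ) (suc zero) j =
  (λ (_ , _ , 1≤j , j<x+1) → 1≤j , ≤-pred (subst (j <_) (+-comm x 1) j<x+1)) ,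
  λ (1≤j , j≤x) → s≤s z≤n , s≤s z≤n , 1≤j , subst (j <_) (+-comm 1 x) (s≤s j≤x)
InShifted⇔Cell (x ∷ μ) (suc (suc i)) zero = (λ ()) , λ ()
InShifted⇔Cell (x ∷ μ) (suc (suc i)) (suc j) =
  (λ { (_ , s≤s i≤ℓ , s≤s i≤j , j<) →
     proj₁ (InShifted⇔Cell μ (suc i) j) (s≤s z≤n , i≤ℓ , i≤j , ≤-pred (subst (suc j <_) (+-suc _ (suc i)) j<)) }) ,
  λ c → let (_ , i≤ℓ , i≤j , j<) = proj₂ (InShifted⇔Cell μ (suc i) j) c
        in s≤s z≤n , s≤s i≤ℓ , s≤s i≤j , subst (suc j <_) (sym (+-suc _ (suc i))) (s≤s j<)

Cell-row₀ : ∀ λ' {j} → ¬ Cell λ' 0 j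
Cell-row₀ [] ()
Cell-row₀ (x ∷ μ) ()

Cell-col₀ : ∀ λ' {i} → ¬ Cell λ' (suc i) 0
Cell-col₀ [] ()
Cell-col₀ (x ∷ μ) {zero} (() , _)
Cell-col₀ (x ∷ μ) {suc i} ()

Cell-∷ : ∀ x μ {i j} → Cell μ i j → Cell (x ∷ μ) (suc i) (suc j)
Cell-∷ x μ {zero} c = ⊥-elim (Cell-row₀ μ c)
Cell-∷ x μ {suc i} c = c

InShifted-restrict : ∀ {λ' μ} {P : ℕ → ℕ → Set} → (∀ i j → Cell λ' i j ↔ (Cell μ i j × P i j)) →
  ∀ i j → InShifted λ' i j ↔ (InShifted μ i j × P i j)
InShifted-restrict {λ'} {μ} cells i j =
  (λ c → let (cμ , Pij) = proj₁ (cells i j) (proj₁ (InShifted⇔Cell λ' i j) c) in proj₂ (InShifted⇔Cell μ i j) cμ , Pij) ,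
  λ (c , Pij) → proj₂ (InShifted⇔Cell λ' i j) (proj₂ (cells i j) (proj₁ (InShifted⇔Cell μ i j) c , Pij))

Stair : ℕ → ℕ → ℕ → Set
Stair m i j = 1 ≤ i × i ≤ j × j ≤ m

Cell-staircase⇔Stair : ∀ m i j → Cell (staircase m) i j ↔ Stair m i j
Cell-staircase⇔Stair zero i j = (λ ()) , λ (1≤i , i≤j , j≤0) → 1+n≰n (≤-trans 1≤i (≤-trans i≤j j≤0))
Cell-staircase⇔Stair (suc m) zero j = (λ ()) , λ ()
Cell-staircase⇔Stair (suc m) (suc zero) j = (λ (1≤j , j≤) → s≤s z≤n , 1≤j , j≤) , λ (_ , 1≤j , j≤) → 1≤j , j≤
Cell-staircase⇔Stair (suc m) (suc (suc i)) zero = (λ ()) , λ { (_ , () , _) }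
Cell-staircase⇔Stair (suc m) (suc (suc i)) (suc j) =
  (λ c → let (_ , i≤j , j≤m) = proj₁ (Cell-staircase⇔Stair m (suc i) j) c in s≤s z≤n , s≤s i≤j , s≤s j≤m) ,
  λ { (_ , s≤s i≤j , s≤s j≤m) → proj₂ (Cell-staircase⇔Stair m (suc i) j) (s≤s z≤n , i≤j , j≤m) }

InShifted-staircase⇔Stair : ∀ m i j → InShifted (staircase m) i j ↔ Stair m i j
InShifted-staircase⇔Stair m i j =
  proj₁ (Cell-staircase⇔Stair m i j) ∘ proj₁ (InShifted⇔Cell (staircase m) i j) ,
  proj₂ (InShifted⇔Cell (staircase m) i j) ∘ proj₂ (Cell-staircase⇔Stair m i j)

staircase-row₁ : ∀ m {i j} → Cell (staircase m) i j → Cell (staircase m) 1 j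
staircase-row₁ m {i} {j} c =
  let (1≤i , i≤j , j≤m) = proj₁ (Cell-staircase⇔Stair m i j) c
  in proj₂ (Cell-staircase⇔Stair m 1 j) (≤-refl , ≤-trans 1≤i i≤j , j≤m)

staircase-diagonal : ∀ m {i j} → Cell (staircase m) i j → Cell (staircase m) i i
staircase-diagonal m {i} {j} c =
  let (1≤i , i≤j , j≤m) = proj₁ (Cell-staircase⇔Stair m i j) c
  in proj₂ (Cell-staircase⇔Stair m i i) (1≤i , ≤-refl , ≤-trans i≤j j≤m)

Stair-reflect : ∀ {m i j} → Stair m i j → Stair m (suc m ∸ j) (suc m ∸ i)
Stair-reflect {m} (1≤i , i≤j , j≤m) = m<n⇒0<n∸m (s≤s j≤m) , ∸-monoʳ-≤ (suc m) i≤j , ∸-monoʳ-≤ (suc m) 1≤i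

Stair-reflect-involutive : ∀ {m i j} → Stair m i j → (suc m ∸ (suc m ∸ j) ≡ j) × (suc m ∸ (suc m ∸ i) ≡ i)
Stair-reflect-involutive (_ , i≤j , j≤m) = m∸[m∸n]≡n (m≤n⇒m≤1+n j≤m) , m∸[m∸n]≡n (m≤n⇒m≤1+n (≤-trans i≤j j≤m))

reflected-cells⇔ : ∀ m {ν} {Q : ℕ → ℕ → Set} →
  (∀ i j → InShifted ν i j ↔ (Stair m i j × Q (suc m ∸ j) (suc m ∸ i))) →
  ∀ i′ j′ → InShifted ν i′ j′ ↔
    (∃[ i ] ∃[ j ] (InShifted (staircase m) i j × Q i j × i′ ≡ suc m ∸ j × j′ ≡ suc m ∸ i))
reflected-cells⇔ m {ν} {Q} cells i′ j′ = forward , backward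
  where
  forward : InShifted ν i′ j′ → ∃[ i ] ∃[ j ] (InShifted (staircase m) i j × Q i j × i′ ≡ suc m ∸ j × j′ ≡ suc m ∸ i)
  forward c = let (st , Qij) = proj₁ (cells i′ j′) c ; (j′≡ , i′≡) = Stair-reflect-involutive st
              in suc m ∸ j′ , suc m ∸ i′ , proj₂ (InShifted-staircase⇔Stair m _ _) (Stair-reflect st) , Qij , sym i′≡ , sym j′≡
  backward : ∃[ i ] ∃[ j ] (InShifted (staircase m) i j × Q i j × i′ ≡ suc m ∸ j × j′ ≡ suc m ∸ i) → InShifted ν i′ j′
  backward (i , j , c , Qij , refl , refl) =
    let st = proj₁ (InShifted-staircase⇔Stair m i j) c ; (j≡ , i≡) = Stair-reflect-involutive st
    in proj₂ (cells _ _) (Stair-reflect st , subst₂ Q (sym i≡) (sym j≡) Qij)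

-- Sums over cells

indicator : {A : Set} → Dec A → ℕ
indicator (yes _) = 1
indicator (no _)  = 0

indicator-yes : {A : Set} (d : Dec A) → A → indicator d ≡ 1
indicator-yes (yes _) _ = refl
indicator-yes (no ¬a) a = ⊥-elim (¬a a)

indicator-no : {A : Set} (d : Dec A) → ¬ A → indicator d ≡ 0
indicator-no (yes a) ¬a = ⊥-elim (¬a a)
indicator-no (no _)  _  = refl

indicator≤1 : {A : Set} (d : Dec A) → indicator d ≤ 1
indicator≤1 (yes _) = s≤s z≤n
indicator≤1 (no _)  = z≤n

indicator-≤-suc : ∀ x t → indicator (x ≤? suc t) ≡ indicator (x ≤? t) + indicator (x ≟ suc t)
indicator-≤-suc x t with x ≤? t | x ≟ suc t
... | yes x≤t | yes refl = ⊥-elim (1+n≰n x≤t)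
... | yes x≤t | no _     = indicator-yes (x ≤? suc t) (m≤n⇒m≤1+n x≤t)
... | no _    | yes refl = indicator-yes (x ≤? suc t) ≤-refl
... | no x≰t  | no x≢    = indicator-no (x ≤? suc t) λ x≤ → x≰t (≤-pred (≤∧≢⇒< x≤ x≢))

rowSum : ℕ → (ℕ → ℕ) → ℕ
rowSum zero    g = 0
rowSum (suc n) g = g 1 + rowSum n (λ j → g (suc j))

cellSum : List ℕ → (ℕ → ℕ → ℕ) → ℕ
cellSum []      f = 0
cellSum (x ∷ μ) f = rowSum x (f 1) + cellSum μ (λ i j → f (suc i) (suc j))

rowSum-cong : ∀ n {g h} → (∀ j → g j ≡ h j) → rowSum n g ≡ rowSum n h
rowSum-cong zero    g≗h = refl
rowSum-cong (suc n) g≗h = cong₂ _+_ (g≗h 1) (rowSum-cong n (λ j → g≗h (suc j)))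

cellSum-cong : ∀ λ' {f g} → (∀ i j → f i j ≡ g i j) → cellSum λ' f ≡ cellSum λ' g
cellSum-cong []      f≗g = refl
cellSum-cong (x ∷ μ) f≗g = cong₂ _+_ (rowSum-cong x (f≗g 1)) (cellSum-cong μ (λ i j → f≗g (suc i) (suc j)))

rowSum-+ : ∀ n g h → rowSum n (λ j → g j + h j) ≡ rowSum n g + rowSum n h
rowSum-+ zero    g h = refl
rowSum-+ (suc n) g h = trans (cong (g 1 + h 1 +_) (rowSum-+ n _ _)) (interchange (g 1) (h 1) _ _)

cellSum-+ : ∀ λ' f g → cellSum λ' (λ i j → f i j + g i j) ≡ cellSum λ' f + cellSum λ' g
cellSum-+ []      f g = refl
cellSum-+ (x ∷ μ) f g =
  trans (cong₂ _+_ (rowSum-+ x (f 1) (g 1)) (cellSum-+ μ _ _)) (interchange (rowSum x (f 1)) _ _ _)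

rowSum-zero : ∀ n g → (∀ j → 1 ≤ j → j ≤ n → g j ≡ 0) → rowSum n g ≡ 0
rowSum-zero zero    g g≡0 = refl
rowSum-zero (suc n) g g≡0 =
  cong₂ _+_ (g≡0 1 ≤-refl (s≤s z≤n)) (rowSum-zero n _ (λ j _ j≤n → g≡0 (suc j) (s≤s z≤n) (s≤s j≤n)))

cellSum-zero : ∀ λ' f → (∀ i j → Cell λ' i j → f i j ≡ 0) → cellSum λ' f ≡ 0
cellSum-zero []      f f≡0 = refl
cellSum-zero (x ∷ μ) f f≡0 =
  cong₂ _+_ (rowSum-zero x (f 1) (λ j 1≤j j≤x → f≡0 1 j (1≤j , j≤x)))
            (cellSum-zero μ _ (λ i j c → f≡0 (suc i) (suc j) (Cell-∷ x μ c)))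

rowSum-supported : ∀ n g {b} → 1 ≤ b → b ≤ n →
  (∀ j → 1 ≤ j → j ≤ n → j ≡ b ⊎ g j ≡ 0) → rowSum n g ≡ g b
rowSum-supported zero    g 1≤b b≤0 _ = ⊥-elim (1+n≰n (≤-trans 1≤b b≤0))
rowSum-supported (suc n) g {suc zero} _ _ supp =
  trans (cong (g 1 +_) (rowSum-zero n _ rest≡0)) (+-identityʳ (g 1))
  where
  rest≡0 : ∀ j → 1 ≤ j → j ≤ n → g (suc j) ≡ 0
  rest≡0 (suc j) _ j≤n with supp (suc (suc j)) (s≤s z≤n) (s≤s j≤n)
  ... | inj₂ g≡0 = g≡0
rowSum-supported (suc n) g {suc (suc b)} _ (s≤s b≤n) supp with supp 1 ≤-refl (s≤s z≤n)
... | inj₂ g1≡0 = cong₂ _+_ g1≡0 (rowSum-supported n _ (s≤s z≤n) b≤n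
  (λ j 1≤j j≤n → map₁ (cong pred) (supp (suc j) (s≤s z≤n) (s≤s j≤n))))

cellSum-supported : ∀ λ' f {a b} → Cell λ' a b →
  (∀ i j → Cell λ' i j → (i ≡ a × j ≡ b) ⊎ f i j ≡ 0) → cellSum λ' f ≡ f a b
cellSum-supported (x ∷ μ) f {suc zero} {b} (1≤b , b≤x) supp =
  trans (cong₂ _+_ (rowSum-supported x (f 1) 1≤b b≤x (λ j 1≤j j≤x → map₁ proj₂ (supp 1 j (1≤j , j≤x))))
                   (cellSum-zero μ _ rest≡0))
        (+-identityʳ (f 1 b))
  where
  rest≡0 : ∀ i j → Cell μ i j → f (suc i) (suc j) ≡ 0
  rest≡0 i j c with supp (suc i) (suc j) (Cell-∷ x μ c)
  ... | inj₁ (refl , _) = ⊥-elim (Cell-row₀ μ c)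
  ... | inj₂ f≡0        = f≡0
cellSum-supported (x ∷ μ) f {suc (suc a)} {suc b} c supp =
  cong₂ _+_ (rowSum-zero x (f 1) row₁≡0)
            (cellSum-supported μ _ c (λ i j c′ →
               map₁ (λ (i≡ , j≡) → cong pred i≡ , cong pred j≡) (supp (suc i) (suc j) (Cell-∷ x μ c′))))
  where
  row₁≡0 : ∀ j → 1 ≤ j → j ≤ x → f 1 j ≡ 0
  row₁≡0 j 1≤j j≤x with supp 1 j (1≤j , j≤x)
  ... | inj₂ f≡0 = f≡0

≤rowSum⇔ : ∀ n {Q : ℕ → Set} (Q? : ∀ j → Dec (Q j)) →
  (∀ {j j′} → 1 ≤ j → j < j′ → j′ ≤ n → Q j′ → Q j) →
  ∀ {j} → 1 ≤ j → ((j ≤ rowSum n (λ j → indicator (Q? j))) ↔ (j ≤ n × Q j))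
≤rowSum⇔ zero Q? _ 1≤j = (λ j≤0 → ⊥-elim (1+n≰n (≤-trans 1≤j j≤0))) , λ (j≤0 , _) → ⊥-elim (1+n≰n (≤-trans 1≤j j≤0))
≤rowSum⇔ (suc n) {Q} Q? closed {j} 1≤j with Q? 1
... | no ¬Q₁ = (λ j≤R → ⊥-elim (1+n≰n (≤-trans 1≤j (≤-trans j≤R (≤-reflexive R≡0))))) ,
               λ (j≤n , Qj) → ⊥-elim (¬Q₁ (toFirst 1≤j j≤n Qj))
  where
  toFirst : ∀ {j} → 1 ≤ j → j ≤ suc n → Q j → Q 1
  toFirst {suc zero}    _   _   Qj = Qj
  toFirst {suc (suc k)} 1≤j j≤n Qj = closed ≤-refl (s≤s (s≤s z≤n)) j≤n Qj
  R≡0 : rowSum n (λ j → indicator (Q? (suc j))) ≡ 0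
  R≡0 = rowSum-zero n _ (λ j _ j≤n → indicator-no (Q? (suc j)) (λ Qj → ¬Q₁ (toFirst (s≤s z≤n) (s≤s j≤n) Qj)))
... | yes Q₁ = forward j 1≤j , backward j 1≤j
  where
  R : ℕ
  R = rowSum n (λ j → indicator (Q? (suc j)))
  tail⇔ : ∀ {j} → 1 ≤ j → (j ≤ R) ↔ (j ≤ n × Q (suc j))
  tail⇔ = ≤rowSum⇔ n (λ j → Q? (suc j)) (λ 1≤j j<j′ j′≤n → closed (s≤s z≤n) (s≤s j<j′) (s≤s j′≤n))
  forward : ∀ j → 1 ≤ j → j ≤ suc R → j ≤ suc n × Q j
  forward (suc zero)    _ _         = s≤s z≤n , Q₁
  forward (suc (suc k)) _ (s≤s k<R) = let (k<n , Qk) = proj₁ (tail⇔ (s≤s z≤n)) k<R in s≤s k<n , Qk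
  backward : ∀ j → 1 ≤ j → j ≤ suc n × Q j → j ≤ suc R
  backward (suc zero)    _ _                   = s≤s z≤n
  backward (suc (suc k)) _ (s≤s k<n , Qk) = s≤s (proj₂ (tail⇔ (s≤s z≤n)) (k<n , Qk))

rowSum≤ : ∀ n g → (∀ j → g j ≤ 1) → rowSum n g ≤ n
rowSum≤ zero    g g≤1 = z≤n
rowSum≤ (suc n) g g≤1 = +-mono-≤ (g≤1 1) (rowSum≤ n _ (λ j → g≤1 (suc j)))

-- Down-closed sets of cells of the staircase

record DownClosed (m : ℕ) (P : ℕ → ℕ → Set) : Set where
  field
    leftward : ∀ {i j j′} → Cell (staircase m) i j → Cell (staircase m) i j′ → j < j′ → P i j′ → P i j
    upward   : ∀ {i i′ j} → Cell (staircase m) i j → Cell (staircase m) i′ j → i < i′ → P i′ j → P i j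

  toRow₁ : ∀ {i j} → Cell (staircase m) i j → P i j → P 1 j
  toRow₁ {zero}        c = ⊥-elim (Cell-row₀ (staircase m) c)
  toRow₁ {suc zero}    _ = id
  toRow₁ {suc (suc _)} c = upward (staircase-row₁ m c) c (s≤s (s≤s z≤n))

  toCorner : ∀ {i j} → Cell (staircase m) i j → P i j → P 1 1
  toCorner c = toCol₁ (staircase-row₁ m c) ∘ toRow₁ c
    where
    toCol₁ : ∀ {j} → Cell (staircase m) 1 j → P 1 j → P 1 1
    toCol₁ {zero}        c = ⊥-elim (Cell-col₀ (staircase m) c)
    toCol₁ {suc zero}    _ = id
    toCol₁ {suc (suc _)} c = leftward (staircase-row₁ m (staircase-diagonal m c)) c (s≤s (s≤s z≤n))

shiftDownClosed : ∀ {m P} → DownClosed (suc m) P → DownClosed m (λ i j → P (suc i) (suc j))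
shiftDownClosed {m} closed = record
  { leftward = λ c c′ j<j′ → leftward (Cell-∷ (suc m) (staircase m) c) (Cell-∷ (suc m) (staircase m) c′) (s≤s j<j′)
  ; upward   = λ c c′ i<i′ → upward (Cell-∷ (suc m) (staircase m) c) (Cell-∷ (suc m) (staircase m) c′) (s≤s i<i′)
  }
  where open DownClosed closed

FitsIn : ℕ → List ℕ → Set
FitsIn m λ' = StrictPartition λ' × All (_≤ m) λ'

record Shape (m : ℕ) (P : ℕ → ℕ → Set) (P? : ∀ i j → Dec (P i j)) : Set where
  field
    parts   : List ℕ
    fits    : FitsIn m parts
    cells   : ∀ i j → Cell parts i j ↔ (Cell (staircase m) i j × P i j)
    size≡   : size parts ≡ cellSum (staircase m) (λ i j → indicator (P? i j))

emptyShape : ∀ m {P} P? → (∀ i j → Cell (staircase m) i j → ¬ P i j) → Shape m P P?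
emptyShape m P? none = record
  { parts   = []
  ; fits    = ([] , []) , []
  ; cells   = λ i j → (λ ()) , λ (c , Pij) → none i j c Pij
  ; size≡   = sym (cellSum-zero (staircase m) _ (λ i j c → indicator-no (P? i j) (none i j c)))
  }

consShape : ∀ m {P} P? → DownClosed (suc m) P → P 1 1 →
  Shape m (λ i j → P (suc i) (suc j)) (λ i j → P? (suc i) (suc j)) → Shape (suc m) P P?
consShape m {P} P? closed P₁₁ rest = record
  { parts   = r ∷ parts
  ; fits    = (proj₂ (row₁ ≤-refl) (s≤s z≤n , P₁₁) ∷ proj₁ (proj₁ fits) ,
               linked parts (proj₁ (proj₁ fits)) (proj₂ (proj₁ fits)) (λ i j → proj₁ (cells i j))) ,
              rowSum≤ (suc m) _ (λ j → indicator≤1 (P? 1 j)) ∷ All.map m≤n⇒m≤1+n (proj₂ fits)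
  ; cells   = cells′
  ; size≡   = cong (r +_) size≡
  }
  where
  open DownClosed closed
  open Shape rest
  r : ℕ
  r = rowSum (suc m) (λ j → indicator (P? 1 j))
  row₁ : ∀ {j} → 1 ≤ j → (j ≤ r) ↔ (j ≤ suc m × P 1 j)
  row₁ = ≤rowSum⇔ (suc m) (P? 1) (λ 1≤j j<j′ j′≤ → leftward (1≤j , ≤-trans (<⇒≤ j<j′) j′≤) (≤-trans 1≤j (<⇒≤ j<j′) , j′≤) j<j′)
  linked : ∀ ν → All (0 <_) ν → Linked _>_ ν →
    (∀ i j → Cell ν i j → Cell (staircase m) i j × P (suc i) (suc j)) → Linked _>_ (r ∷ ν)
  linked []      _         _  _      = [-]
  -- the cell (2, y + 1) lies in P, hence so does (1, y + 1): the first row is longer than y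
  linked (y ∷ ν) (0<y ∷ _) ν↘ cellsν = proj₂ (row₁ (s≤s z≤n)) (s≤s y≤m , P₁y′) ∷ ν↘
    where
    c : Cell (staircase m) 1 y
    c = proj₁ (cellsν 1 y (0<y , ≤-refl))
    y≤m : y ≤ m
    y≤m = proj₂ (proj₂ (proj₁ (Cell-staircase⇔Stair m 1 y) c))
    P₁y′ : P 1 (suc y)
    P₁y′ = upward (s≤s z≤n , s≤s y≤m) (Cell-∷ (suc m) (staircase m) c) (s≤s (s≤s z≤n)) (proj₂ (cellsν 1 y (0<y , ≤-refl)))
  cells′ : ∀ i j → Cell (r ∷ parts) i j ↔ (Cell (staircase (suc m)) i j × P i j)
  cells′ zero          j       = (λ ()) , λ ()
  cells′ (suc zero)    j       = (λ (1≤j , j≤r) → let (j≤ , Pj) = proj₁ (row₁ 1≤j) j≤r in (1≤j , j≤) , Pj) ,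
                                 λ ((1≤j , j≤) , Pj) → 1≤j , proj₂ (row₁ 1≤j) (j≤ , Pj)
  cells′ (suc (suc i)) zero    = (λ ()) , λ ()
  cells′ (suc (suc i)) (suc j) = cells (suc i) j

downClosed⇒shape : ∀ m {P} P? → DownClosed m P → Shape m P P?
downClosed⇒shape zero    P? _ = emptyShape zero P? (λ _ _ ())
downClosed⇒shape (suc m) P? closed with P? 1 1
... | yes P₁₁ = consShape m P? closed P₁₁ (downClosed⇒shape m _ (shiftDownClosed closed))
... | no ¬P₁₁ = emptyShape (suc m) P? (λ _ _ c → ¬P₁₁ ∘ DownClosed.toCorner closed c)

-- The complementary strict partition

>-trans : ∀ {a b c} → a > b → b > c → a > c
>-trans a>b b>c = <-trans b>c a>b

Linked⇒All< : ∀ {x μ} → Linked _>_ (x ∷ μ) → All (_< x) μ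
Linked⇒All< [-]         = []
Linked⇒All< (x>y ∷ μ↘) = Linkedₚ.Linked⇒All >-trans x>y μ↘

staircase-strict : ∀ m → StrictPartition (staircase m)
staircase-strict zero          = [] , []
staircase-strict (suc zero)    = s≤s z≤n ∷ [] , [-]
staircase-strict (suc (suc m)) =
  let (pos , ↘) = staircase-strict (suc m) in s≤s z≤n ∷ pos , ≤-refl ∷ ↘

∈-staircase : ∀ m {k} → (k ∈ staircase m) ↔ (1 ≤ k × k ≤ m)
∈-staircase zero          = (λ ()) , λ (1≤k , k≤0) → ⊥-elim (1+n≰n (≤-trans 1≤k k≤0))
∈-staircase (suc m) {k} = forward , backward
  where
  forward : k ∈ staircase (suc m) → 1 ≤ k × k ≤ suc m
  forward (here refl) = s≤s z≤n , ≤-refl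
  forward (there k∈)  = let (1≤k , k≤m) = proj₁ (∈-staircase m) k∈ in 1≤k , m≤n⇒m≤1+n k≤m
  backward : 1 ≤ k × k ≤ suc m → k ∈ staircase (suc m)
  backward (1≤k , k≤) with k ≟ suc m
  ... | yes refl = here refl
  ... | no k≢    = there (proj₂ (∈-staircase m) (1≤k , ≤-pred (≤∧≢⇒< k≤ k≢)))

complement : ℕ → List ℕ → List ℕ
complement m λ' = filter (_∉? λ') (staircase m)

complement-strict : ∀ m λ' → StrictPartition (complement m λ')
complement-strict m λ' =
  let (pos , ↘) = staircase-strict m in Allₚ.filter⁺ (_∉? λ') pos , Linkedₚ.filter⁺ (_∉? λ') >-trans ↘

data TopView (m : ℕ) : List ℕ → Set where
  top    : ∀ {μ} → FitsIn m μ → TopView m (suc m ∷ μ)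
  no-top : ∀ {λ'} → suc m ∉ λ' → FitsIn m λ' → TopView m λ'

topView : ∀ {m λ'} → FitsIn (suc m) λ' → TopView m λ'
topView {m} {[]} _ = no-top (λ ()) (([] , []) , [])
topView {m} {x ∷ μ} ((0<x ∷ pos , ↘) , x≤ ∷ _) with x ≟ suc m
... | yes refl = top ((pos , Linked.tail ↘) , All.map ≤-pred (Linked⇒All< ↘))
... | no x≢    = no-top top∉ ((0<x ∷ pos , ↘) , x≤m ∷ All.map (λ y<x → <⇒≤ (<-≤-trans y<x x≤m)) (Linked⇒All< ↘))
  where
  x≤m : x ≤ m
  x≤m = ≤-pred (≤∧≢⇒< x≤ x≢)
  top∉ : suc m ∉ x ∷ μ
  top∉ (here refl) = x≢ refl
  top∉ (there m∈)  = 1+n≰n (≤-trans (All.lookup (Linked⇒All< ↘) m∈) x≤)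

filter-cong-on : ∀ {P Q : ℕ → Set} (P? : Decidable P) (Q? : Decidable Q) {xs} →
  All (λ x → P x ↔ Q x) xs → filter P? xs ≡ filter Q? xs
filter-cong-on P? Q? []                          = refl
filter-cong-on P? Q? {x ∷ _} ((P→Q , Q→P) ∷ P⇔Q) with P? x
... | yes Px = trans (cong (x ∷_) (filter-cong-on P? Q? P⇔Q)) (sym (filter-accept Q? (P→Q Px)))
... | no ¬Px = trans (filter-cong-on P? Q? P⇔Q) (sym (filter-reject Q? (¬Px ∘ Q→P)))

complement-top : ∀ m μ → complement (suc m) (suc m ∷ μ) ≡ complement m μ
complement-top m μ =
  trans (filter-reject (_∉? (suc m ∷ μ)) (λ ∉ → ∉ (here refl)))
        (filter-cong-on (_∉? (suc m ∷ μ)) (_∉? μ) (All.tabulate below))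
  where
  below : ∀ {k} → k ∈ staircase m → (k ∉ suc m ∷ μ) ↔ (k ∉ μ)
  below k∈ = (λ ∉ → ∉ ∘ there) , λ { ∉ (here refl) → 1+n≰n (proj₂ (proj₁ (∈-staircase m) k∈)) ; ∉ (there k∈μ) → ∉ k∈μ }

complement-no-top : ∀ m {λ'} → suc m ∉ λ' → complement (suc m) λ' ≡ suc m ∷ complement m λ'
complement-no-top m {λ'} ∉ = filter-accept (_∉? λ') ∉

∈-complement : ∀ m λ' {k} → (k ∈ complement m λ') ↔ (1 ≤ k × k ≤ m × k ∉ λ')
∈-complement m λ' =
  (λ k∈ → let (k∈m , ∉) = ∈-filter⁻ (_∉? λ') k∈ ; (1≤k , k≤m) = proj₁ (∈-staircase m) k∈m in 1≤k , k≤m , ∉) ,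
  λ (1≤k , k≤m , ∉) → ∈-filter⁺ (_∉? λ') (proj₂ (∈-staircase m) (1≤k , k≤m)) ∉

size-complement : ∀ m {λ'} → FitsIn m λ' → size λ' + size (complement m λ') ≡ size (staircase m)
size-complement zero    {[]}    _                      = refl
size-complement zero    {x ∷ _} ((0<x ∷ _ , _) , x≤0 ∷ _) = ⊥-elim (1+n≰n (≤-trans 0<x x≤0))
size-complement (suc m) fits with topView fits
... | top {μ} fitsμ = begin
  (suc m + size μ) + size (complement (suc m) (suc m ∷ μ)) ≡⟨ cong ((suc m + size μ) +_) (cong size (complement-top m μ)) ⟩
  (suc m + size μ) + size (complement m μ)                  ≡⟨ +-assoc (suc m) (size μ) _ ⟩
  suc m + (size μ + size (complement m μ))                  ≡⟨ cong (suc m +_) (size-complement m fitsμ) ⟩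
  suc m + size (staircase m)                                 ∎
  where open ≡-Reasoning
... | no-top {λ'} ∉ fits′ = begin
  size λ' + size (complement (suc m) λ')       ≡⟨ cong (size λ' +_) (cong size (complement-no-top m ∉)) ⟩
  size λ' + (suc m + size (complement m λ'))   ≡⟨ x∙yz≈y∙xz (size λ') (suc m) _ ⟩
  suc m + (size λ' + size (complement m λ'))   ≡⟨ cong (suc m +_) (size-complement m fits′) ⟩
  suc m + size (staircase m)                    ∎
  where open ≡-Reasoning

Cell-col≤head : ∀ {x μ} → Linked _>_ (x ∷ μ) → ∀ {i j} → Cell (x ∷ μ) i j → j ≤ x
Cell-col≤head _ {suc zero} (_ , j≤x) = j≤x
Cell-col≤head {μ = y ∷ _} (y<x ∷ ↘) {suc (suc i)} {suc _} c = ≤-trans (s≤s (Cell-col≤head ↘ {suc i} c)) y<x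

Cell-col≤ : ∀ {m λ'} → FitsIn m λ' → ∀ {i j} → Cell λ' i j → j ≤ m
Cell-col≤ {λ' = x ∷ _} ((_ , ↘) , x≤m ∷ _) {i} c = ≤-trans (Cell-col≤head ↘ {i} c) x≤m

Cell-∷⇔ : ∀ x μ {p q} → 1 ≤ p → Cell (x ∷ μ) (suc p) (suc q) ↔ Cell μ p q
Cell-∷⇔ x μ {suc p} _ = id , id

Cell-∷-reflect : ∀ x μ {m i j} → i ≤ j → j ≤ m →
  Cell (x ∷ μ) (suc (suc m) ∸ j) (suc (suc m) ∸ i) ↔ Cell μ (suc m ∸ j) (suc m ∸ i)
Cell-∷-reflect x μ {m} {i} {j} i≤j j≤m
  rewrite +-∸-assoc 1 (m≤n⇒m≤1+n j≤m) | +-∸-assoc 1 (m≤n⇒m≤1+n (≤-trans i≤j j≤m)) =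
  Cell-∷⇔ x μ (m<n⇒0<n∸m (s≤s j≤m))

Cell-reflect-top : ∀ m μ {i} → 1 ≤ i → i ≤ suc m → Cell (suc m ∷ μ) (suc (suc m) ∸ suc m) (suc (suc m) ∸ i)
Cell-reflect-top m μ 1≤i i≤ rewrite m+n∸n≡m 1 m = m<n⇒0<n∸m (s≤s i≤) , ∸-monoʳ-≤ (suc (suc m)) 1≤i

Cell-complement : ∀ m {λ'} → FitsIn m λ' → ∀ i j →
  Cell (complement m λ') i j ↔ (Cell (staircase m) i j × ¬ Cell λ' (suc m ∸ j) (suc m ∸ i))
Cell-complement zero    _ i j = (λ ()) , λ { (() , _) }
Cell-complement (suc m) fits with topView fits
... | top {μ} fitsμ rewrite complement-top m μ = λ i j → forward , backward
  where
  forward : ∀ {i j} → Cell (complement m μ) i j →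
    Cell (staircase (suc m)) i j × ¬ Cell (suc m ∷ μ) (suc (suc m) ∸ j) (suc (suc m) ∸ i)
  forward {i} {j} c =
    let (cm , ¬μ) = proj₁ (Cell-complement m fitsμ i j) c
        (1≤i , i≤j , j≤m) = proj₁ (Cell-staircase⇔Stair m i j) cm
    in proj₂ (Cell-staircase⇔Stair (suc m) i j) (1≤i , i≤j , m≤n⇒m≤1+n j≤m) ,
       ¬μ ∘ proj₁ (Cell-∷-reflect (suc m) μ i≤j j≤m)
  backward : ∀ {i j} → Cell (staircase (suc m)) i j × ¬ Cell (suc m ∷ μ) (suc (suc m) ∸ j) (suc (suc m) ∸ i) →
    Cell (complement m μ) i j
  backward {i} {j} (c , ¬λ) with proj₁ (Cell-staircase⇔Stair (suc m) i j) c | j ≤? m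
  ... | 1≤i , i≤j , _  | yes j≤m = proj₂ (Cell-complement m fitsμ i j)
    (proj₂ (Cell-staircase⇔Stair m i j) (1≤i , i≤j , j≤m) , ¬λ ∘ proj₂ (Cell-∷-reflect (suc m) μ i≤j j≤m))
  -- here j = m + 1, whose reflection is the whole first row of λ' = m + 1 ∷ μ
  ... | 1≤i , i≤j , j≤ | no j≰m = ⊥-elim (¬λ (subst (λ j → Cell (suc m ∷ μ) (suc (suc m) ∸ j) (suc (suc m) ∸ i))
    (≤-antisym (≰⇒> j≰m) j≤) (Cell-reflect-top m μ 1≤i (≤-trans i≤j j≤))))
... | no-top {λ'} ∉ fits′ rewrite complement-no-top m ∉ = cells
  where
  cells : ∀ i j → Cell (suc m ∷ complement m λ') i j ↔
    (Cell (staircase (suc m)) i j × ¬ Cell λ' (suc (suc m) ∸ j) (suc (suc m) ∸ i))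
  cells zero          j       = (λ ()) , λ { (() , _) }
  cells (suc zero)    j       = (λ c → c , λ c′ → 1+n≰n (Cell-col≤ fits′ {suc (suc m) ∸ j} c′)) , proj₁
  cells (suc (suc i)) zero    = (λ ()) , λ { (() , _) }
  cells (suc (suc i)) (suc j) = Cell-complement m fits′ (suc i) j

complement-split : ∀ m {λ'} → FitsIn m λ' → ∀ k → (1 ≤ k × k ≤ m) ↔ (k ∈ λ' ⊎ k ∈ complement m λ')
complement-split m {λ'} ((pos , _) , bounded) k = forward , backward
  where
  forward : 1 ≤ k × k ≤ m → k ∈ λ' ⊎ k ∈ complement m λ'
  forward (1≤k , k≤m) with k ∈? λ'
  ... | yes k∈ = inj₁ k∈
  ... | no k∉  = inj₂ (proj₂ (∈-complement m λ') (1≤k , k≤m , k∉))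
  backward : k ∈ λ' ⊎ k ∈ complement m λ' → 1 ≤ k × k ≤ m
  backward (inj₁ k∈) = All.lookup pos k∈ , All.lookup bounded k∈
  backward (inj₂ k∈) = let (1≤k , k≤m , _) = proj₁ (∈-complement m λ') k∈ in 1≤k , k≤m

complement-disjoint : ∀ m λ' {k} → k ∈ λ' → k ∈ complement m λ' → ⊥
complement-disjoint m λ' k∈ k∈c = proj₂ (proj₂ (proj₁ (∈-complement m λ') k∈c)) k∈

InShifted-complement : ∀ m {λ'} {P : ℕ → ℕ → Set} → FitsIn m λ' → (∀ i j → Cell λ' i j ↔ (Cell (staircase m) i j × P i j)) →
  ∀ i j → InShifted (complement m λ') i j ↔ (Stair m i j × ¬ P (suc m ∸ j) (suc m ∸ i))
InShifted-complement m {λ'} {P} fits cells i j = forward , backward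
  where
  reflected : Stair m i j → Cell (staircase m) (suc m ∸ j) (suc m ∸ i)
  reflected = proj₂ (Cell-staircase⇔Stair m _ _) ∘ Stair-reflect
  forward : InShifted (complement m λ') i j → Stair m i j × ¬ P (suc m ∸ j) (suc m ∸ i)
  forward c =
    let (cm , ¬cλ) = proj₁ (Cell-complement m fits i j) (proj₁ (InShifted⇔Cell (complement m λ') i j) c)
        st = proj₁ (Cell-staircase⇔Stair m i j) cm
    in st , λ Pij → ¬cλ (proj₂ (cells _ _) (reflected st , Pij))
  backward : Stair m i j × ¬ P (suc m ∸ j) (suc m ∸ i) → InShifted (complement m λ') i j
  backward (st , ¬P) = proj₂ (InShifted⇔Cell (complement m λ') i j)
    (proj₂ (Cell-complement m fits i j) (proj₂ (Cell-staircase⇔Stair m i j) st , ¬P ∘ proj₂ ∘ proj₁ (cells _ _)))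

-- Standard Young tableaux

cellSum-indicator-≡ : ∀ {μ T} → IsShiftedSYT μ T → ∀ {k} → 1 ≤ k → k ≤ size μ →
  cellSum μ (λ i j → indicator (T i j ≟ k)) ≡ 1
cellSum-indicator-≡ {μ} {T} (_ , inj , surj , _) {k} 1≤k k≤ with surj k 1≤k k≤
... | a , b , inAB , Tab≡k =
  trans (cellSum-supported μ _ (proj₁ (InShifted⇔Cell μ a b) inAB) onlyAt) (indicator-yes (T a b ≟ k) Tab≡k)
  where
  onlyAt : ∀ i j → Cell μ i j → (i ≡ a × j ≡ b) ⊎ indicator (T i j ≟ k) ≡ 0
  onlyAt i j c with T i j ≟ k
  ... | yes Tij≡k = inj₁ (inj i j a b (proj₂ (InShifted⇔Cell μ i j) c) inAB (trans Tij≡k (sym Tab≡k)))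
  ... | no _      = inj₂ refl

cellSum-indicator-≤ : ∀ {μ T} → IsShiftedSYT μ T → ∀ t → t ≤ size μ → cellSum μ (λ i j → indicator (T i j ≤? t)) ≡ t
cellSum-indicator-≤ {μ} {T} (range , _) zero _ = cellSum-zero μ _ (λ i j c → indicator-no (T i j ≤? 0) (λ Tij≤0 →
  1+n≰n (≤-trans (proj₁ (range i j (proj₂ (InShifted⇔Cell μ i j) c))) Tij≤0)))
cellSum-indicator-≤ {μ} {T} syt (suc t) t<size = begin
  cellSum μ (λ i j → indicator (T i j ≤? suc t))                            ≡⟨ cellSum-cong μ (λ i j → indicator-≤-suc (T i j) t) ⟩
  cellSum μ (λ i j → indicator (T i j ≤? t) + indicator (T i j ≟ suc t))   ≡⟨ cellSum-+ μ _ _ ⟩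
  cellSum μ (λ i j → indicator (T i j ≤? t)) + cellSum μ (λ i j → indicator (T i j ≟ suc t))
    ≡⟨ cong₂ _+_ (cellSum-indicator-≤ {μ} syt t (<⇒≤ t<size)) (cellSum-indicator-≡ {μ} syt (s≤s z≤n) t<size) ⟩
  t + 1                                                                       ≡⟨ +-comm t 1 ⟩
  suc t                                                                       ∎
  where open ≡-Reasoning

restrict-SYT : ∀ {μ λ' T t} → IsShiftedSYT μ T → t ≤ size μ →
  (∀ i j → InShifted λ' i j ↔ (InShifted μ i j × T i j ≤ t)) → size λ' ≡ t → IsShiftedSYT λ' T
restrict-SYT {μ} {λ'} {T} {t} (range , inj , surj , rows , cols) t≤size cells refl =
  (λ i j c → proj₁ (range i j (inμ c)) , proj₂ (proj₁ (cells i j) c)) ,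
  (λ i j i′ j′ c c′ → inj i j i′ j′ (inμ c) (inμ c′)) ,
  (λ k 1≤k k≤t → let (i , j , c , Tij≡k) = surj k 1≤k (≤-trans k≤t t≤size)
                 in i , j , proj₂ (cells i j) (c , subst (_≤ t) (sym Tij≡k) k≤t) , Tij≡k) ,
  (λ i j j′ c c′ → rows i j j′ (inμ c) (inμ c′)) ,
  (λ i i′ j c c′ → cols i i′ j (inμ c) (inμ c′))
  where
  inμ : ∀ {i j} → InShifted λ' i j → InShifted μ i j
  inμ {i} {j} c = proj₁ (proj₁ (cells i j) c)

≤-downClosed : ∀ {m T} t → IsShiftedSYT (staircase m) T → DownClosed m (λ i j → T i j ≤ t)
≤-downClosed {m} t (_ , _ , _ , rows , cols) = record
  { leftward = λ c c′ j<j′ → ≤-trans (<⇒≤ (rows _ _ _ (toIn c) (toIn c′) j<j′))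
  ; upward   = λ c c′ i<i′ → ≤-trans (<⇒≤ (cols _ _ _ (toIn c) (toIn c′) i<i′))
  }
  where
  toIn : ∀ {i j} → Cell (staircase m) i j → InShifted (staircase m) i j
  toIn = proj₂ (InShifted⇔Cell (staircase m) _ _)

bigM≡size : ∀ m → bigM m ≡ size (staircase m)
bigM≡size zero    = refl
bigM≡size (suc m) =
  trans (sym (nCk+nC[k+1]≡[n+1]C[k+1] (suc m) 1)) (cong₂ _+_ (nC1≡n (suc m)) (bigM≡size m))

reflect-SYT : ∀ {m ν T t} → IsShiftedSYT (staircase m) T →
  (∀ i j → InShifted ν i j ↔ (Stair m i j × t < T (suc m ∸ j) (suc m ∸ i))) →
  t + size ν ≡ size (staircase m) → IsShiftedSYT ν (T₂fill m T)
reflect-SYT {m} {ν} {T} {t} (range , inj , surj , rows , cols) cells t+ν≡M =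
  fill-range , fill-injective , fill-surjective , fill-rows , fill-cols
  where
  M : ℕ
  M = size (staircase m)
  R : ℕ → ℕ → ℕ
  R i j = T (suc m ∸ j) (suc m ∸ i)
  fill≡ : ∀ i j → T₂fill m T i j ≡ suc M ∸ R i j
  fill≡ i j = cong (_∸ R i j) (trans (cong (_+ 1) (bigM≡size m)) (+-comm M 1))
  size≡ : size ν ≡ M ∸ t
  size≡ = trans (sym (m+n∸m≡n t (size ν))) (cong (_∸ t) t+ν≡M)
  stair : ∀ {i j} → InShifted ν i j → Stair m i j
  stair {i} {j} c = proj₁ (proj₁ (cells i j) c)
  i≤ : ∀ {i j} → InShifted ν i j → i ≤ suc m
  i≤ c = let (_ , i≤j , j≤m) = stair c in m≤n⇒m≤1+n (≤-trans i≤j j≤m)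
  j≤ : ∀ {i j} → InShifted ν i j → j ≤ suc m
  j≤ c = let (_ , _ , j≤m) = stair c in m≤n⇒m≤1+n j≤m
  source : ∀ {i j} → InShifted ν i j → InShifted (staircase m) (suc m ∸ j) (suc m ∸ i)
  source c = proj₂ (InShifted-staircase⇔Stair m _ _) (Stair-reflect (stair c))
  R≤M : ∀ {i j} → InShifted ν i j → R i j ≤ M
  R≤M c = proj₂ (range _ _ (source c))
  ≤M : ∀ {k} → k ≤ size ν → k ≤ M
  ≤M k≤ν = ≤-trans k≤ν (subst (size ν ≤_) t+ν≡M (m≤n+m (size ν) t))
  flip< : ∀ {x y} → x < y → y ≤ M → suc M ∸ y < suc M ∸ x
  flip< x<y y≤M = ∸-monoʳ-< x<y (m≤n⇒m≤1+n y≤M)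

  fill-range : ∀ i j → InShifted ν i j → 1 ≤ T₂fill m T i j × T₂fill m T i j ≤ size ν
  fill-range i j c rewrite fill≡ i j | size≡ =
    m<n⇒0<n∸m (s≤s (R≤M c)) , ∸-monoʳ-≤ (suc M) (proj₂ (proj₁ (cells i j) c))

  fill-injective : ∀ i j i′ j′ → InShifted ν i j → InShifted ν i′ j′ →
    T₂fill m T i j ≡ T₂fill m T i′ j′ → i ≡ i′ × j ≡ j′
  fill-injective i j i′ j′ c c′ eq =
    let R≡ = ∸-cancelˡ-≡ (m≤n⇒m≤1+n (R≤M c)) (m≤n⇒m≤1+n (R≤M c′)) (trans (sym (fill≡ i j)) (trans eq (fill≡ i′ j′)))
        (rows≡ , cols≡) = inj _ _ _ _ (source c) (source c′) R≡
    in ∸-cancelˡ-≡ (i≤ c) (i≤ c′) cols≡ , ∸-cancelˡ-≡ (j≤ c) (j≤ c′) rows≡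

  fill-surjective : ∀ k → 1 ≤ k → k ≤ size ν → ∃[ i ] ∃[ j ] (InShifted ν i j × T₂fill m T i j ≡ k)
  fill-surjective k 1≤k k≤ν with surj (suc M ∸ k) (m<n⇒0<n∸m (s≤s (≤M k≤ν))) (∸-monoʳ-≤ (suc M) 1≤k)
  ... | p , q , c , Tpq≡ = suc m ∸ q , suc m ∸ p , proj₂ (cells (suc m ∸ q) (suc m ∸ p)) (Stair-reflect st , t<R) , value
    where
    st : Stair m p q
    st = proj₁ (InShifted-staircase⇔Stair m p q) c
    R≡ : R (suc m ∸ q) (suc m ∸ p) ≡ suc M ∸ k
    R≡ = let (q≡ , p≡) = Stair-reflect-involutive st in trans (cong₂ T p≡ q≡) Tpq≡
    t<R : t < R (suc m ∸ q) (suc m ∸ p)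
    t<R = subst (t <_) (sym R≡) (m+n≤o⇒m≤o∸n (suc t) (s≤s (subst (t + k ≤_) t+ν≡M (+-monoʳ-≤ t k≤ν))))
    value : T₂fill m T (suc m ∸ q) (suc m ∸ p) ≡ k
    value = trans (fill≡ (suc m ∸ q) (suc m ∸ p)) (trans (cong (suc M ∸_) R≡) (m∸[m∸n]≡n (m≤n⇒m≤1+n (≤M k≤ν))))

  fill-rows : ∀ i j j′ → InShifted ν i j → InShifted ν i j′ → j < j′ → T₂fill m T i j < T₂fill m T i j′
  fill-rows i j j′ c c′ j<j′ rewrite fill≡ i j | fill≡ i j′ =
    flip< (cols _ _ _ (source c′) (source c) (∸-monoʳ-< j<j′ (j≤ c′))) (R≤M c)

  fill-cols : ∀ i i′ j → InShifted ν i j → InShifted ν i′ j → i < i′ → T₂fill m T i j < T₂fill m T i′ j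
  fill-cols i i′ j c c′ i<i′ rewrite fill≡ i j | fill≡ i′ j =
    flip< (rows _ _ _ (source c′) (source c) (∸-monoʳ-< i<i′ (i≤ c′))) (R≤M c)

lemma4p2 : (m t : ℕ) → t ≤ bigM m → (T : ℕ → ℕ → ℕ) → IsShiftedSYT (staircase m) T →
    ∃[ λ₁ ] ∃[ λ₂ ]
      ( StrictPartition λ₁ × StrictPartition λ₂
      × (∀ i j → InShifted λ₁ i j ↔ (InShifted (staircase m) i j × T i j ≤ t))
      × IsShiftedSYT λ₁ T
      × (∀ i' j' → InShifted λ₂ i' j' ↔
            (∃[ i ] ∃[ j ] (InShifted (staircase m) i j × t < T i j
                            × i' ≡ suc m ∸ j × j' ≡ suc m ∸ i)))
      × IsShiftedSYT λ₂ (T₂fill m T)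
      × (∀ k → ((1 ≤ k) × (k ≤ m)) ↔ ((k ∈ λ₁) ⊎ (k ∈ λ₂)))
      × (∀ k → k ∈ λ₁ → k ∈ λ₂ → ⊥) )
lemma4p2 m t t≤bigM T syt =
  λ₁ , λ₂ , proj₁ fits , complement-strict m λ₁ , cells₁ , restrict-SYT {staircase m} {λ₁} syt t≤M cells₁ size₁ ,
  reflected-cells⇔ m {λ₂} reflected₂ , reflect-SYT {ν = λ₂} syt reflected₂ sizes ,
  complement-split m fits , λ _ → complement-disjoint m λ₁
  where
  t≤M : t ≤ size (staircase m)
  t≤M = subst (t ≤_) (bigM≡size m) t≤bigM
  open Shape (downClosed⇒shape m (λ i j → T i j ≤? t) (≤-downClosed t syt)) renaming (parts to λ₁)
  λ₂ : List ℕ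
  λ₂ = complement m λ₁
  cells₁ : ∀ i j → InShifted λ₁ i j ↔ (InShifted (staircase m) i j × T i j ≤ t)
  cells₁ = InShifted-restrict {λ₁} {staircase m} cells
  size₁ : size λ₁ ≡ t
  size₁ = trans size≡ (cellSum-indicator-≤ {staircase m} syt t t≤M)
  reflected₂ : ∀ i j → InShifted λ₂ i j ↔ (Stair m i j × t < T (suc m ∸ j) (suc m ∸ i))
  reflected₂ i j = let (to , from) = InShifted-complement m fits cells i j
                   in (λ c → let (st , T≰t) = to c in st , ≰⇒> T≰t) , λ (st , t<T) → from (st , <⇒≱ t<T)
  sizes : t + size λ₂ ≡ size (staircase m)
  sizes = trans (cong (_+ size λ₂) (sym size₁)) (size-complement m fits)
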